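{- Let $m,p,r$ be positive integers with $p\mid m$ and $m>p$. Suppose $P\in\mathrm{APS}(m,1,2r+1)$ and $P$ contains some element $\xi^a(x)$ with $a<m-p$ (i.e. $P\cap\mathbb{I}^{m-p}_{2r+1}\ne\emptyset$, where $\mathbb{I}^{m-p}_{2r+1}$ is identified with $\bigcup_{a=0}^{m-p-1}\xi^a[2r+1]$). Then $P\in\mathrm{APS}(m,p,2r+1)$.
   Context: $[n]=\{1,\dots,n\}$, $\xi=e^{2\pi i/m}$; $\xi^a(x)$ denotes $\xi^a\cdot x$ for $0\le a\le m-1$, $x\in[n]$; $\xi^a[n]=\{\xi^a(1),\dots,\xi^a(n)\}$; $\mathbb{I}_n^m=\bigcup_{a=0}^{m-1}\xi^a[n]$, totally ordered by $\xi^a(x)\prec\xi^b(y)$ iff $a>b$, or $a=b$ and $x>y$. $\mathbb{Z}_m\wr S_n$ is the group of bijections $w$ of $\mathbb{I}_n^m$ with $w(\xi^i x)=\xi^i w(x)$ for $x\in[n]$, all $i$, written $w(n)\cdots w(1)$. $\operatorname{Pin}(w)=\{w(i):2\le i\le n-1,\ w(i+1)\prec w(i)\succ w(i-1)\}$. For $w$ with $w(i)=\xi^{e_i}(x_i)$, $e_i\in\{0,\dots,m-1\}$, $\varepsilon_w=\sum_i e_i$. For $p\mid m$, $G(m,p,n)=\{w\in\mathbb{Z}_m\wr S_n:\varepsilon_w\equiv0\pmod p\}$. $\mathrm{APS}(m,p,n)$ is the set of all $P\subseteq\mathbb{I}_n^m$ with $P=\operatorname{Pin}(w)$ for some $w\in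 G(m,p,n)$; $\mathrm{APS}(m,1,n)$ uses $G(m,1,n)=\mathbb{Z}_m\wr S_n$. -}

module Defs where

open import Data.Nat using (ℕ; zero; suc; _+_; _<_; _∸_)
open import Data.Fin using (Fin; toℕ; fromℕ<)
open import Data.Bool using (Bool; true)
open import Data.List using (map; allFin)
open import Data.Nat.ListAction using (sum)
open import Data.Product using (Σ; ∃; _×_; _,_; proj₁; proj₂)
open import Data.Sum using (_⊎_)
open import Data.Nat.Divisibility using (_∣_)
open import Relation.Binary.PropositionalEquality using (_≡_)
open import Function.Definitions using (Bijective)
open import Function.Bundles using (_⇔_)

-- An element of 𝕀ₙᵐ: the pair (a , x) encodes ξ^a (toℕ x + 1),
-- with a ∈ {0,…,m-1} and toℕ x + 1 ∈ [n].
Elem : ℕ → ℕ → Set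
Elem m n = Fin m × Fin n

_≺_ : ∀ {m n} → Elem m n → Elem m n → Set
(a , x) ≺ (b , y) = (toℕ b < toℕ a) ⊎ ((a ≡ b) × (toℕ y < toℕ x))

-- An element w of ℤ_m ≀ S_n is determined by its values on [n]:
-- w (i+1) = ξ^{e_i}(x_i), encoded as w i = (e_i , x_i - 1) for i : Fin n.
-- The ξ-equivariant extension is a bijection of 𝕀ₙᵐ iff i ↦ x_i is a
-- bijection of [n].
record Wreath (m n : ℕ) : Set where
  field
    fun   : Fin n → Elem m n
    bij   : Bijective _≡_ _≡_ (λ i → proj₂ (fun i))
open Wreath public

ε : ∀ {m n} → Wreath m n → ℕ
ε {m} {n} w = sum (map (λ i → toℕ (proj₁ (fun w i))) (allFin n))

InG : (m p n : ℕ) → Wreath m n → Set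
InG m p n w = p ∣ ε w

-- z ∈ Pin(w): z = w(i) for some 2 ≤ i ≤ n-1 with w(i+1) ≺ w(i) ≻ w(i-1).
-- Here k (0-based) is the position of i-1, so i-1, i, i+1 are k, k+1, k+2.
InPin : ∀ {m n} → Wreath m n → Elem m n → Set
InPin {m} {n} w z =
  Σ ℕ λ k → Σ (suc (suc k) < n) λ h →
    let w₀ = fun w (fromℕ< {k} (lt2 h))
        w₁ = fun w (fromℕ< {suc k} (lt1 h))
        w₂ = fun w (fromℕ< h)
    in (w₁ ≡ z) × (w₂ ≺ w₁) × (w₀ ≺ w₁)
  where
    open import Data.Nat.Properties using (<-trans; n<1+n)
    lt1 : ∀ {k} → suc (suc k) < n → suc k < n
    lt1 {k} h = <-trans (n<1+n (suc k)) h
    lt2 : ∀ {k} → suc (suc k) < n → k < n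
    lt2 {k} h = <-trans (n<1+n k) (lt1 h)

Subset : ℕ → ℕ → Set
Subset m n = Elem m n → Bool

APS : (m p n : ℕ) → Subset m n → Set
APS m p n P = Σ (Wreath m n) λ w → InG m p n w × (∀ z → (P z ≡ true) ⇔ InPin w z)

{-# OPTIONS --safe #-}
module Submission where

-- In the order ≺ a larger colour makes a letter smaller. Pin(w) only records which letters exceed
-- both of their neighbours, so it survives any rearrangement of the letters of w with the same
-- peaks, and recolouring a letter y that lies below both neighbours before and after the change.
-- Given a pinnacle of colour below m − p, the maximum M also has colour below m − p. If M is at an
-- end it is no peak and is set aside; otherwise the letters on its two sides can be merged, by
-- repeatedly splitting at maxima, into y ∷ Y with the union of their peaks, and y ∷ M ∷ Y has the
-- peaks of w. So w can be rearranged to put some y between neighbours of colour below m − p that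
-- exceed y. Recolouring y with any colour in [m − p, m) keeps it below them, and one of these p
-- consecutive colours makes ε divisible by p.

open import Defs
open import Data.Bool using (true)
open import Data.Empty using (⊥; ⊥-elim)
open import Data.Fin as Fin using (Fin; toℕ; fromℕ<; cast)
open import Data.Fin.Properties using (toℕ-fromℕ<; cast-is-id)
import Data.Fin.Properties as Finₚ
open import Data.List using (List; []; _∷_; _++_; [_]; _∷ʳ_; length; last; head; map; tabulate; lookup)
open import Data.List.Membership.Propositional using (_∈_)
open import Data.List.Membership.Propositional.Properties using (∈-++⁺ʳ; ∈-++⁻; ∈-tabulate⁺; ∈-tabulate⁻)
open import Data.List.Properties
  using (length-++; length-map; length-tabulate; ++-assoc; ∷-injectiveʳ; ++-conicalʳ; map-++; map-tabulate;
         tabulate-cong; tabulate-lookup)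
open import Data.List.Relation.Binary.Permutation.Propositional
  using (_↭_; ↭-refl; ↭-sym; ↭-trans; ↭-prep; ↭-swap; ↭-reflexive; ↭⇒↭ₛ; module PermutationReasoning)
open import Data.List.Relation.Binary.Permutation.Propositional.Properties as ↭
  using (All-resp-↭; ∈-resp-↭; shift; ++⁺ˡ; ++-comm; ∷↭∷ʳ; ↭-singleton-inv; ↭-length)
import Data.List.Relation.Binary.Permutation.Setoid.Properties as ↭ₛ
open import Data.List.Relation.Unary.All as All using (All; []; _∷_)
open import Data.List.Relation.Unary.All.Properties as Allₚ using (++⁺)
open import Data.List.Relation.Unary.AllPairs using (_∷_)
open import Data.List.Relation.Unary.Any using (here; there)
open import Data.List.Relation.Unary.Unique.Propositional using (Unique)
open import Data.List.Relation.Unary.Unique.Propositional.Properties using (tabulate⁺)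
import Data.Maybe.Relation.Unary.All as Maybe
open import Data.Nat using (ℕ; zero; suc; _+_; _*_; _∸_; _<_; _≤_; s≤s; z≤n; z<s; NonZero)
open import Data.Nat.DivMod using (_%_; _/_; m≡m%n+[m/n]*n; m%n<n)
open import Data.Nat.Divisibility using (_∣_; divides)
open import Data.Nat.Induction using (<-wellFounded)
open import Data.Nat.ListAction using (sum)
open import Data.Nat.ListAction.Properties using (sum-↭)
open import Data.Nat.Properties
  using (≤-refl; ≤-trans; ≤-reflexive; <-trans; <-≤-trans; <⇒≤; n<1+n; m<m+n; m≤n+m; +-monoˡ-<; +-comm;
         m∸n≤m; ∸-monoʳ-≤; +-∸-comm; m+n∸m≡n)
open import Data.Product using (Σ; Σ-syntax; _×_; _,_; proj₁; proj₂)
open import Data.Product.Relation.Binary.Lex.Strict using (×-isStrictTotalOrder)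
open import Data.Product.Relation.Binary.Pointwise.NonDependent using (≡×≡⇒≡; ≡⇒≡×≡)
open import Data.Sum as Sum using (inj₁; inj₂)
open import Function using (id; _∘_)
open import Function.Bundles using (mk⇔; Equivalence)
open import Function.Definitions using (Bijective)
open import Induction.WellFounded using (Acc; acc)
open import Level using (0ℓ)
open import Relation.Binary using (Rel; IsStrictTotalOrder; Trichotomous; tri<; tri≈; tri>)
import Relation.Binary.Construct.Flip.EqAndOrd as Flip
open import Relation.Binary.PropositionalEquality
  using (_≡_; _≢_; refl; sym; trans; cong; subst; setoid; isEquivalence; resp₂; module ≡-Reasoning)
open import Relation.Unary using (Pred; _⊆_; _≐_; _∪_; _∩_; ｛_｝)
open import Relation.Unary.Algebra using (∪-cong; ∪-comm; ∪-assoc)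
open import Relation.Unary.Properties using (≐-refl; ≐-sym; ≐-trans)
open import Relation.Unary.Relation.Binary.Equality using (≐-setoid)

module _ {A : Set} where

  Unique-resp-↭ : ∀ {xs ys : List A} → xs ↭ ys → Unique xs → Unique ys
  Unique-resp-↭ xs↭ys = ↭ₛ.Unique-resp-↭ (setoid A) (↭⇒↭ₛ xs↭ys)

  Unique-++⁻ʳ : ∀ xs {ys : List A} → Unique (xs ++ ys) → Unique ys
  Unique-++⁻ʳ []       u        = u
  Unique-++⁻ʳ (_ ∷ xs) (_ ∷ u) = Unique-++⁻ʳ xs u

  Unique-++⁻ˡ : ∀ xs {ys : List A} → Unique (xs ++ ys) → Unique xs
  Unique-++⁻ˡ xs {ys} u = Unique-++⁻ʳ ys (Unique-resp-↭ (++-comm xs ys) u)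

  Unique-drop-mid : ∀ xs {y} {ys : List A} → Unique (xs ++ y ∷ ys) → Unique (xs ++ ys)
  Unique-drop-mid xs {y} {ys} u with Unique-resp-↭ (shift y xs ys) u
  ... | _ ∷ u′ = u′

  Unique-++-disjoint : ∀ xs {ys : List A} {x} → Unique (xs ++ ys) → x ∈ xs → x ∈ ys → ⊥
  Unique-++-disjoint (_ ∷ xs) (x∉ ∷ _) (here refl) x∈ys = All.lookup x∉ (∈-++⁺ʳ xs x∈ys) refl
  Unique-++-disjoint (_ ∷ xs) (_ ∷ u)  (there x∈xs) x∈ys = Unique-++-disjoint xs u x∈xs x∈ys

  length-<-++ˡ : ∀ xs {y} {ys : List A} → length xs < length (xs ++ y ∷ ys)
  length-<-++ˡ xs {y} {ys} = subst (length xs <_) (sym (length-++ xs)) (m<m+n (length xs) z<s)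

  length-<-++ʳ : ∀ xs {y} {ys : List A} → length ys < length (xs ++ y ∷ ys)
  length-<-++ʳ xs {y} {ys} = subst (length ys <_) (sym (length-++ xs)) (m≤n+m (suc (length ys)) (length xs))

  last-∷ : ∀ {P : Pred A 0ℓ} {x} xs → P x → Maybe.All P (last xs) → Maybe.All P (last (x ∷ xs))
  last-∷ []       px _  = Maybe.just px
  last-∷ (_ ∷ _) _  pl = pl

module PeakSets {E : Set} {_≺_ : Rel E 0ℓ} (≺-isStrictTotalOrder : IsStrictTotalOrder _≡_ _≺_) where

  open IsStrictTotalOrder ≺-isStrictTotalOrder using (compare; asym) renaming (trans to ≺-trans)
  open import Relation.Binary.Reasoning.Setoid (≐-setoid E 0ℓ)

  private
    variable
      x y z u v w M : E
      n : ℕ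
      xs ys zs : List E

  data Peak : List E → Pred E 0ℓ where
    peak  : x ≺ y → z ≺ y → Peak (x ∷ y ∷ z ∷ zs) y
    later : Peak xs y → Peak (x ∷ xs) y

  Peak⇒∈ : Peak xs y → y ∈ xs
  Peak⇒∈ (peak _ _) = there (here refl)
  Peak⇒∈ (later p)  = there (Peak⇒∈ p)

  Peak⇒≢[] : Peak xs y → xs ≢ []
  Peak⇒≢[] (peak _ _) ()
  Peak⇒≢[] (later _)  ()

  Peak-++⁺ˡ : ∀ ys → Peak xs ⊆ Peak (xs ++ ys)
  Peak-++⁺ˡ ys (peak x≺y z≺y) = peak x≺y z≺y
  Peak-++⁺ˡ ys (later p)      = later (Peak-++⁺ˡ ys p)

  Peak-++⁺ʳ : ∀ xs → Peak ys ⊆ Peak (xs ++ ys)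
  Peak-++⁺ʳ []       p = p
  Peak-++⁺ʳ (_ ∷ xs) p = later (Peak-++⁺ʳ xs p)

  Peak-[x]-∪ : ∀ {P : Pred E 0ℓ} → Peak [ x ] ∪ P ≐ P
  Peak-[x]-∪ = Sum.[ (λ { (later ()) }) , id ] , inj₂

  Peak-∷-max : All (_≺ M) xs → Peak (M ∷ xs) ≐ Peak xs
  Peak-∷-max xs≺M = drop xs≺M , later
    where
    drop : All (_≺ M) xs → Peak (M ∷ xs) ⊆ Peak xs
    drop (y≺M ∷ _) (peak M≺y _) = ⊥-elim (asym M≺y y≺M)
    drop _         (later p)    = p

  Peak-∷ʳ-max : ∀ xs → All (_≺ M) xs → Peak (xs ∷ʳ M) ≐ Peak xs
  Peak-∷ʳ-max xs xs≺M = drop xs xs≺M , Peak-++⁺ˡ [ _ ]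
    where
    drop : ∀ xs → All (_≺ M) xs → Peak (xs ∷ʳ M) ⊆ Peak xs
    drop []                 _                 (later ())
    drop (_ ∷ _ ∷ [])       (_ ∷ y≺M ∷ [])    (peak _ M≺y) = ⊥-elim (asym M≺y y≺M)
    drop (_ ∷ _ ∷ _ ∷ _)    _                 (peak x≺y z≺y) = peak x≺y z≺y
    drop (_ ∷ xs)           (_ ∷ xs≺M)        (later p) = later (drop xs xs≺M p)

  Peak-++-max : ∀ xs → All (_≺ M) xs → All (_≺ M) ys → xs ≢ [] → ys ≢ [] →
                Peak (xs ++ M ∷ ys) ≐ ｛ M ｝ ∪ Peak xs ∪ Peak ys
  Peak-++-max {M} {ys} xs xs≺M ys≺M xs≢[] ys≢[] = split xs xs≺M xs≢[] , join
    where
    split : ∀ xs → All (_≺ M) xs → xs ≢ [] → Peak (xs ++ M ∷ ys) ⊆ ｛ M ｝ ∪ Peak xs ∪ Peak ys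
    split []             _                 xs≢[] _              = ⊥-elim (xs≢[] refl)
    split (_ ∷ [])       _                 _     (peak _ _)     = inj₁ refl
    split (_ ∷ [])       _                 _     (later p)      = inj₂ (inj₂ (proj₁ (Peak-∷-max ys≺M) p))
    split (_ ∷ _ ∷ [])   (_ ∷ y≺M ∷ [])    _     (peak _ M≺y)   = ⊥-elim (asym M≺y y≺M)
    split (_ ∷ _ ∷ _ ∷ _) _                _     (peak x≺y z≺y) = inj₂ (inj₁ (peak x≺y z≺y))
    split (_ ∷ xs@(_ ∷ _)) (_ ∷ xs≺M)      _     (later p)      =
      Sum.map₂ (Sum.map₁ later) (split xs xs≺M (λ ()) p)

    apex : ∀ xs ys → All (_≺ M) xs → All (_≺ M) ys → xs ≢ [] → ys ≢ [] → Peak (xs ++ M ∷ ys) M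
    apex []               _       _            _          xs≢[] _     = ⊥-elim (xs≢[] refl)
    apex (_ ∷ [])         []      _            _          _     ys≢[] = ⊥-elim (ys≢[] refl)
    apex (_ ∷ [])         (_ ∷ _) (x≺M ∷ [])   (y≺M ∷ _)  _     _     = peak x≺M y≺M
    apex (_ ∷ xs@(_ ∷ _)) ys      (_ ∷ xs≺M)   ys≺M       _     ys≢[] = later (apex xs ys xs≺M ys≺M (λ ()) ys≢[])

    join : ｛ M ｝ ∪ Peak xs ∪ Peak ys ⊆ Peak (xs ++ M ∷ ys)
    join (inj₁ refl)      = apex xs ys xs≺M ys≺M xs≢[] ys≢[]
    join (inj₂ (inj₁ p))  = Peak-++⁺ˡ _ p
    join (inj₂ (inj₂ p))  = Peak-++⁺ʳ xs (later p)

  Flanked : Pred E 0ℓ → List E → List E → Set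
  Flanked P xs ys = Maybe.All P (last xs) × Maybe.All P (head ys)

  Peak-replace : ∀ xs → Flanked (v ≺_) xs ys → Flanked (w ≺_) xs ys →
                 Peak (xs ++ v ∷ ys) ≐ Peak (xs ++ w ∷ ys)
  Peak-replace xs v-flanked w-flanked = replace xs v-flanked w-flanked , replace xs w-flanked v-flanked
    where
    replace : ∀ {v w} xs → Flanked (v ≺_) xs ys → Flanked (w ≺_) xs ys → Peak (xs ++ v ∷ ys) ⊆ Peak (xs ++ w ∷ ys)
    replace []              _                  (_ , Maybe.just w≺y) (peak _ z≺y)   = peak w≺y z≺y
    replace []              _                  _                    (later p)      = later p
    replace (_ ∷ [])        (Maybe.just v≺x , _) _                  (peak x≺v _)   = ⊥-elim (asym v≺x x≺v)
    replace (_ ∷ [])        (_ , v-right)      (_ , w-right)        (later p)      =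
      later (replace [] (Maybe.nothing , v-right) (Maybe.nothing , w-right) p)
    replace (_ ∷ _ ∷ [])    _                  (Maybe.just w≺y , _) (peak x≺y _)   = peak x≺y w≺y
    replace (_ ∷ _ ∷ _ ∷ _) _                  _                    (peak x≺y z≺y) = peak x≺y z≺y
    replace (_ ∷ xs@(_ ∷ _)) v-flanked         w-flanked            (later p)      =
      later (replace xs v-flanked w-flanked p)

  All-≺-++-max : All (_≺ M) xs → All (_≺ M) ys → M ≺ x → All (_≺ x) (xs ++ M ∷ ys)
  All-≺-++-max xs≺M ys≺M M≺x = ++⁺ (All.map (λ y≺M → ≺-trans y≺M M≺x) xs≺M)
                                   (M≺x ∷ All.map (λ y≺M → ≺-trans y≺M M≺x) ys≺M)

  data MaxSplit (xs : List E) : Set where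
    split : ∀ {ys M zs} → xs ≡ ys ++ M ∷ zs → All (_≺ M) ys → All (_≺ M) zs → MaxSplit xs

  maxSplit : xs ≢ [] → Unique xs → MaxSplit xs
  maxSplit {[]}              xs≢[] _ = ⊥-elim (xs≢[] refl)
  maxSplit {_ ∷ []}          _     _ = split refl [] []
  maxSplit {x ∷ xs@(_ ∷ _)} _     (x∉xs ∷ xs!) with maxSplit (λ ()) xs!
  ... | split {ys} {M} {zs} eq ys≺M zs≺M with compare x M
  ...   | tri< x≺M _ _ = split (cong (x ∷_) eq) (x≺M ∷ ys≺M) zs≺M
  ...   | tri≈ _ refl _ = ⊥-elim (All.lookup x∉xs (subst (x ∈_) (sym eq) (∈-++⁺ʳ ys (here refl))) refl)
  ...   | tri> _ _ M≺x = split {ys = []} refl [] (subst (All (_≺ x)) (sym eq) (All-≺-++-max ys≺M zs≺M M≺x))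

  record PeakMerge (xs ys : List E) : Set where
    constructor merged
    field
      freed : E
      rest  : List E
      perm  : freed ∷ rest ↭ xs ++ ys
      peaks : Peak rest ≐ Peak xs ∪ Peak ys

  PeakMerge-comm : PeakMerge ys xs → PeakMerge xs ys
  PeakMerge-comm {ys} {xs} (merged y Y p e) = merged y Y (↭-trans p (++-comm ys xs)) (≐-trans e (∪-comm _ _))

  PeakMerge-All : ∀ {P : Pred E 0ℓ} → All P xs → All P ys → (m : PeakMerge xs ys) →
                  All P (PeakMerge.freed m ∷ PeakMerge.rest m)
  PeakMerge-All Pxs Pys (merged _ _ p _) = All-resp-↭ (↭-sym p) (++⁺ Pxs Pys)

  PeakMerge-rest≢[] : xs ≢ [] → ys ≢ [] → (m : PeakMerge xs ys) → PeakMerge.rest m ≢ []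
  PeakMerge-rest≢[] {[]}    xs≢[] _ _ _ = xs≢[] refl
  PeakMerge-rest≢[] {_ ∷ xs} {ys} _ ys≢[] (merged _ _ p _) refl =
    ys≢[] (++-conicalʳ xs ys (∷-injectiveʳ (↭-singleton-inv (↭-sym p))))

  private
    mutual
      peakMerge-acc : ∀ xs ys → xs ≢ [] → ys ≢ [] → Unique (xs ++ ys) →
                      Acc _<_ n → length xs + length ys ≤ n → PeakMerge xs ys
      peakMerge-acc xs ys xs≢[] ys≢[] xs++ys! ac bound
        with maxSplit xs≢[] (Unique-++⁻ˡ xs xs++ys!) | maxSplit ys≢[] (Unique-++⁻ʳ xs xs++ys!)
      ... | split {A₁} {a} {A₂} refl A₁≺a A₂≺a | split {B₁} {b} {B₂} refl B₁≺b B₂≺b with compare a b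
      ... | tri> _ _ b≺a = peakMergeAtMax A₁ A₂ ys A₁≺a A₂≺a (All-≺-++-max B₁≺b B₂≺b b≺a) ys≢[]
                             (Unique-drop-mid A₁ (subst Unique (++-assoc A₁ (a ∷ A₂) ys) xs++ys!)) ac bound
      ... | tri< a≺b _ _ = PeakMerge-comm (peakMergeAtMax B₁ B₂ xs B₁≺b B₂≺b (All-≺-++-max A₁≺a A₂≺a a≺b) xs≢[]
                             (Unique-drop-mid B₁ (subst Unique (++-assoc B₁ (b ∷ B₂) xs)
                                                          (Unique-resp-↭ (++-comm xs ys) xs++ys!)))
                             ac (≤-trans (≤-reflexive (+-comm (length ys) (length xs))) bound))
      ... | tri≈ _ refl _ = ⊥-elim (Unique-++-disjoint xs xs++ys! (∈-++⁺ʳ A₁ (here refl)) (∈-++⁺ʳ B₁ (here refl)))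

      -- u, the larger of the two maxima, is a peak of A₁ ++ u ∷ A₂ iff A₁ and A₂ are nonempty; so the
      -- result is A₁ ++ u ∷ (A₂ merged with B), or u ∷ (A₁ merged with B) when A₂ = [].
      peakMergeAtMax : ∀ A₁ A₂ B → All (_≺ u) A₁ → All (_≺ u) A₂ → All (_≺ u) B → B ≢ [] →
                       Unique (A₁ ++ A₂ ++ B) → Acc _<_ n → length (A₁ ++ u ∷ A₂) + length B ≤ n →
                       PeakMerge (A₁ ++ u ∷ A₂) B
      peakMergeAtMax {u} [] [] B _ _ _ _ _ _ _ = merged u B ↭-refl (≐-sym Peak-[x]-∪)
      peakMergeAtMax {u} [] A₂@(_ ∷ _) B _ A₂≺u B≺u B≢[] A₂++B! (acc rec) bound
        with peakMerge-acc A₂ B (λ ()) B≢[] A₂++B! (rec bound) ≤-refl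
      ... | m@(merged y Y p e) = merged y (u ∷ Y) (↭-trans (↭-swap y u ↭-refl) (↭-prep u p)) (begin
        Peak (u ∷ Y)            ≈⟨ Peak-∷-max (All.tail (PeakMerge-All A₂≺u B≺u m)) ⟩
        Peak Y                  ≈⟨ e ⟩
        Peak A₂ ∪ Peak B        ≈⟨ ∪-cong (≐-sym (Peak-∷-max A₂≺u)) ≐-refl ⟩
        Peak (u ∷ A₂) ∪ Peak B  ∎)
      peakMergeAtMax {u} A₁@(_ ∷ _) [] B A₁≺u _ B≺u B≢[] A₁++B! (acc rec) bound
        with peakMerge-acc A₁ B (λ ()) B≢[] A₁++B!
               (rec (<-≤-trans (+-monoˡ-< (length B) (length-<-++ˡ A₁)) bound)) ≤-refl
      ... | m@(merged y Y p e) = merged y (u ∷ Y) perm (begin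
        Peak (u ∷ Y)             ≈⟨ Peak-∷-max (All.tail (PeakMerge-All A₁≺u B≺u m)) ⟩
        Peak Y                   ≈⟨ e ⟩
        Peak A₁ ∪ Peak B         ≈⟨ ∪-cong (≐-sym (Peak-∷ʳ-max A₁ A₁≺u)) ≐-refl ⟩
        Peak (A₁ ∷ʳ u) ∪ Peak B  ∎)
        where
        perm : y ∷ u ∷ Y ↭ (A₁ ∷ʳ u) ++ B
        perm = ↭-trans (↭-swap y u ↭-refl) (↭-trans (↭-prep u p)
                 (↭-sym (↭-trans (↭-reflexive (++-assoc A₁ [ u ] B)) (shift u A₁ B))))
      peakMergeAtMax {u} A₁@(_ ∷ _) A₂@(_ ∷ _) B A₁≺u A₂≺u B≺u B≢[] A₁++A₂++B! (acc rec) bound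
        with peakMerge-acc A₂ B (λ ()) B≢[] (Unique-++⁻ʳ A₁ A₁++A₂++B!)
               (rec (<-≤-trans (+-monoˡ-< (length B) (length-<-++ʳ A₁)) bound)) ≤-refl
      ... | m@(merged y Y p e) = merged y (A₁ ++ u ∷ Y) perm (begin
        Peak (A₁ ++ u ∷ Y)                           ≈⟨ Peak-++-max A₁ A₁≺u (All.tail (PeakMerge-All A₂≺u B≺u m))
                                                                           (λ ()) (PeakMerge-rest≢[] (λ ()) B≢[] m) ⟩
        ｛ u ｝ ∪ Peak A₁ ∪ Peak Y                   ≈⟨ ∪-cong ≐-refl (∪-cong ≐-refl e) ⟩
        ｛ u ｝ ∪ Peak A₁ ∪ Peak A₂ ∪ Peak B         ≈⟨ ∪-cong ≐-refl (≐-sym (∪-assoc _ _ _)) ⟩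
        ｛ u ｝ ∪ (Peak A₁ ∪ Peak A₂) ∪ Peak B       ≈⟨ ≐-sym (∪-assoc _ _ _) ⟩
        (｛ u ｝ ∪ Peak A₁ ∪ Peak A₂) ∪ Peak B       ≈⟨ ∪-cong (≐-sym (Peak-++-max A₁ A₁≺u A₂≺u (λ ()) (λ ()))) ≐-refl ⟩
        Peak (A₁ ++ u ∷ A₂) ∪ Peak B                 ∎)
        where
        perm : y ∷ A₁ ++ u ∷ Y ↭ (A₁ ++ u ∷ A₂) ++ B
        perm = ↭-trans (↭-sym (shift y A₁ (u ∷ Y))) (↭-trans (++⁺ˡ A₁ (↭-trans (↭-swap y u ↭-refl) (↭-prep u p)))
                 (↭-reflexive (sym (++-assoc A₁ (u ∷ A₂) B))))

  peakMerge : ∀ xs ys → xs ≢ [] → ys ≢ [] → Unique (xs ++ ys) → PeakMerge xs ys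
  peakMerge xs ys xs≢[] ys≢[] xs++ys! = peakMerge-acc xs ys xs≢[] ys≢[] xs++ys! (<-wellFounded _) ≤-refl

  module _ {H : Pred E 0ℓ} (H-up : ∀ {x y} → H x → x ≺ y → H y) where

    record ValleyArrangement (xs : List E) : Set where
      constructor arrangement
      field
        left   : List E
        valley : E
        right  : List E
        perm   : left ++ valley ∷ right ↭ xs
        peaks  : Peak (left ++ valley ∷ right) ≐ Peak xs
        walls  : Flanked ((valley ≺_) ∩ H) left right

    ValleyArrangement-resp : xs ↭ ys → Peak xs ≐ Peak ys → ValleyArrangement xs → ValleyArrangement ys
    ValleyArrangement-resp xs↭ys xs≐ys (arrangement X y Z p e f) =
      arrangement X y Z (↭-trans p xs↭ys) (≐-trans e xs≐ys) f

    ValleyArrangement-∷-max : All (_≺ M) xs → H M → ValleyArrangement xs → ValleyArrangement (M ∷ xs)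
    ValleyArrangement-∷-max {M} xs≺M HM (arrangement X y Z p e (left , right)) =
      arrangement (M ∷ X) y Z (↭-prep M p) (≐-trans (Peak-∷-max XyZ≺M) (≐-trans e (≐-sym (Peak-∷-max xs≺M))))
        (last-∷ X (All.lookup XyZ≺M (∈-++⁺ʳ X (here refl)) , HM) left , right)
      where
      XyZ≺M : All (_≺ M) (X ++ y ∷ Z)
      XyZ≺M = All-resp-↭ (↭-sym p) xs≺M

    H-max : ∀ xs → All (_≺ M) xs → All (_≺ M) ys → z ∈ xs ++ M ∷ ys → H z → H M
    H-max xs xs≺M ys≺M z∈ Hz with ∈-++⁻ xs z∈
    ... | inj₁ z∈xs        = H-up Hz (All.lookup xs≺M z∈xs)
    ... | inj₂ (here refl) = Hz
    ... | inj₂ (there z∈ys) = H-up Hz (All.lookup ys≺M z∈ys)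

    private
      -- M is in H since it dominates the peak z; when both sides of M are nonempty they are merged
      -- into y ∷ Y, and y ∷ M ∷ Y puts the freed y next to M.
      valleyArrangement-acc : ∀ xs → Unique xs → Peak xs z → H z → Acc _<_ (length xs) → ValleyArrangement xs
      valleyArrangement-acc xs xs! pz Hz (acc rec) with maxSplit (Peak⇒≢[] pz) xs!
      ... | split {[]} {M} {B} refl _ B≺M =
        ValleyArrangement-∷-max B≺M (H-max [] [] B≺M (Peak⇒∈ pz) Hz)
          (valleyArrangement-acc B (Unique-++⁻ʳ [ M ] xs!) (proj₁ (Peak-∷-max B≺M) pz) Hz (rec ≤-refl))
      valleyArrangement-acc xs xs! pz Hz (acc rec)
          | split {A@(_ ∷ _)} {M} {[]} refl A≺M _ =
        ValleyArrangement-resp (∷↭∷ʳ M A) (≐-trans (Peak-∷-max A≺M) (≐-sym (Peak-∷ʳ-max A A≺M)))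
          (ValleyArrangement-∷-max A≺M (H-max A A≺M [] (Peak⇒∈ pz) Hz)
            (valleyArrangement-acc A (Unique-++⁻ˡ A xs!) (proj₁ (Peak-∷ʳ-max A A≺M) pz) Hz (rec (length-<-++ˡ A))))
      valleyArrangement-acc xs xs! pz Hz (acc rec)
          | split {A@(_ ∷ _)} {M} {B@(_ ∷ _)} refl A≺M B≺M
          with peakMerge A B (λ ()) (λ ()) (Unique-drop-mid A xs!)
      ... | m@(merged y Y p e) = arrangement [] y (M ∷ Y) perm (begin
        Peak (y ∷ M ∷ Y)
          ≈⟨ Peak-++-max [ y ] (y≺M ∷ []) Y≺M (λ ()) (PeakMerge-rest≢[] (λ ()) (λ ()) m) ⟩
        ｛ M ｝ ∪ Peak [ y ] ∪ Peak Y      ≈⟨ ∪-cong ≐-refl Peak-[x]-∪ ⟩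
        ｛ M ｝ ∪ Peak Y                  ≈⟨ ∪-cong ≐-refl e ⟩
        ｛ M ｝ ∪ Peak A ∪ Peak B         ≈⟨ ≐-sym (Peak-++-max A A≺M B≺M (λ ()) (λ ())) ⟩
        Peak (A ++ M ∷ B)                 ∎)
        (Maybe.nothing , Maybe.just (y≺M , H-max A A≺M B≺M (Peak⇒∈ pz) Hz))
        where
        yY≺M : All (_≺ M) (y ∷ Y)
        yY≺M = PeakMerge-All A≺M B≺M m
        y≺M = All.head yY≺M
        Y≺M = All.tail yY≺M
        perm : y ∷ M ∷ Y ↭ A ++ M ∷ B
        perm = ↭-trans (↭-swap y M ↭-refl) (↭-trans (↭-prep M p) (↭-sym (shift M A B)))

    valleyArrangement : ∀ xs → Unique xs → Peak xs z → H z → ValleyArrangement xs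
    valleyArrangement xs xs! pz Hz = valleyArrangement-acc xs xs! pz Hz (<-wellFounded _)

Unique-tabulate⁻ : ∀ {A : Set} {k} {f : Fin k → A} → Unique (tabulate f) → ∀ {i j} → f i ≡ f j → i ≡ j
Unique-tabulate⁻ _          {Fin.zero}  {Fin.zero}  _  = refl
Unique-tabulate⁻ (f₀∉ ∷ _) {Fin.zero}  {Fin.suc j} eq = ⊥-elim (Allₚ.tabulate⁻ f₀∉ j eq)
Unique-tabulate⁻ (f₀∉ ∷ _) {Fin.suc i} {Fin.zero}  eq = ⊥-elim (Allₚ.tabulate⁻ f₀∉ i (sym eq))
Unique-tabulate⁻ (_ ∷ u)   {Fin.suc i} {Fin.suc j} eq = cong Fin.suc (Unique-tabulate⁻ u eq)

Bijective-resp-↭ : ∀ {A : Set} {k} {f g : Fin k → A} → tabulate f ↭ tabulate g →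
                   Bijective _≡_ _≡_ g → Bijective _≡_ _≡_ f
Bijective-resp-↭ {f = f} {g} f↭g (g-injective , g-surjective) = f-injective , f-surjective
  where
  f-injective : ∀ {i j} → f i ≡ f j → i ≡ j
  f-injective = Unique-tabulate⁻ (Unique-resp-↭ (↭-sym f↭g) (tabulate⁺ g-injective))
  f-surjective : ∀ y → Σ[ i ∈ _ ] (∀ {j} → j ≡ i → f j ≡ y)
  f-surjective y with g-surjective y
  ... | j , gj≡y with ∈-tabulate⁻ (∈-resp-↭ (↭-sym f↭g) (∈-tabulate⁺ j))
  ...   | i , gj≡fi = i , λ { refl → trans (sym gj≡fi) (gj≡y refl) }

tabulate-lookup-cast : ∀ {A : Set} (xs : List A) {k} (eq : length xs ≡ k) →
                       tabulate (lookup xs ∘ cast (sym eq)) ≡ xs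
tabulate-lookup-cast xs refl =
  trans (tabulate-cong (λ i → cong (lookup xs) (cast-is-id refl i))) (tabulate-lookup xs)

colour-fixing : ∀ {m} p .{{_ : NonZero p}} → p < m → ∀ S → Σ[ c ∈ Fin m ] m ∸ p ≤ toℕ c × p ∣ toℕ c + S
colour-fixing {suc k} p (s≤s p≤k) S =
  fromℕ< c<1+k , subst (suc k ∸ p ≤_) (sym toℕ-c) lower , subst (λ t → p ∣ t + S) (sym toℕ-c) divisible
  where
  open ≡-Reasoning
  T = k + S
  r = T % p
  r<p : r < p
  r<p = m%n<n T p
  r≤k : r ≤ k
  r≤k = ≤-trans (<⇒≤ r<p) p≤k
  c<1+k : k ∸ r < suc k
  c<1+k = s≤s (m∸n≤m k r)
  toℕ-c : toℕ (fromℕ< c<1+k) ≡ k ∸ r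
  toℕ-c = toℕ-fromℕ< c<1+k
  lower : suc k ∸ p ≤ k ∸ r
  lower = ∸-monoʳ-≤ (suc k) r<p
  divisible : p ∣ (k ∸ r) + S
  divisible = divides (T / p) (begin
    (k ∸ r) + S          ≡⟨ +-∸-comm S r≤k ⟨
    T ∸ r                ≡⟨ cong (_∸ r) (m≡m%n+[m/n]*n T p) ⟩
    (r + T / p * p) ∸ r  ≡⟨ m+n∸m≡n r (T / p * p) ⟩
    T / p * p            ∎)

-- Unfolded, ≺ is the lexicographic product of the reversed orders on Fin m and Fin n.
≺-isStrictTotalOrder : ∀ {m n} → IsStrictTotalOrder _≡_ (_≺_ {m} {n})
≺-isStrictTotalOrder {m} {n} = record
  { isStrictPartialOrder = record
      { isEquivalence = isEquivalence
      ; irrefl        = Lex.irrefl ∘ ≡⇒≡×≡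
      ; trans         = Lex.trans
      ; <-resp-≈      = resp₂ _≺_
      }
  ; compare = compare
  }
  where
  module Lex = IsStrictTotalOrder (×-isStrictTotalOrder (Flip.isStrictTotalOrder (Finₚ.<-isStrictTotalOrder {m}))
                                                         (Flip.isStrictTotalOrder (Finₚ.<-isStrictTotalOrder {n})))
  compare : Trichotomous _≡_ _≺_
  compare x y with Lex.compare x y
  ... | tri< x≺y x≢y y⊀x = tri< x≺y (x≢y ∘ ≡⇒≡×≡) y⊀x
  ... | tri≈ x⊀y x≡y y⊀x = tri≈ x⊀y (≡×≡⇒≡ x≡y) y⊀x
  ... | tri> x⊀y x≢y y≺x = tri> x⊀y (x≢y ∘ ≡⇒≡×≡) y≺x

-- InPin for an arbitrary sequence f; the body is copied from Defs, so that InPin w is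
-- definitionally InPinSeq (fun w).
InPinSeq : ∀ {m n k} → (Fin k → Elem m n) → Elem m n → Set
InPinSeq {k = k} f z =
  Σ ℕ λ i → Σ (suc (suc i) < k) λ h →
    let w₀ = f (fromℕ< {i} (lt2 h))
        w₁ = f (fromℕ< {suc i} (lt1 h))
        w₂ = f (fromℕ< h)
    in (w₁ ≡ z) × (w₂ ≺ w₁) × (w₀ ≺ w₁)
  where
    lt1 : ∀ {i} → suc (suc i) < k → suc i < k
    lt1 {i} h = <-trans (n<1+n (suc i)) h
    lt2 : ∀ {i} → suc (suc i) < k → i < k
    lt2 {i} h = <-trans (n<1+n i) (lt1 h)

module _ {m n : ℕ} where

  open PeakSets (≺-isStrictTotalOrder {m} {n})

  table : Wreath m n → List (Elem m n)
  table w = tabulate (fun w)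

  colour : Elem m n → ℕ
  colour = toℕ ∘ proj₁

  table-unique : (w : Wreath m n) → Unique (table w)
  table-unique w = tabulate⁺ (λ eq → proj₁ (bij w) (cong proj₂ eq))

  ε≡sum-colours : (w : Wreath m n) → ε w ≡ sum (map colour (table w))
  ε≡sum-colours w = cong sum (trans (map-tabulate id _) (sym (map-tabulate (fun w) colour)))

  InPinSeq-∷ : ∀ {k} (f : Fin (suc (suc (suc k))) → Elem m n) →
              InPinSeq (f ∘ Fin.suc) ≐ Peak (tabulate (f ∘ Fin.suc)) → InPinSeq f ≐ Peak (tabulate f)
  InPinSeq-∷ f (to-tail , from-tail) = to , from
    where
    to : InPinSeq f ⊆ Peak (tabulate f)
    to (zero  , _     , refl , w₂≺w₁ , w₀≺w₁) = peak w₀≺w₁ w₂≺w₁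
    to (suc i , s≤s h , pin)                  = later (to-tail (i , h , pin))
    from : Peak (tabulate f) ⊆ InPinSeq f
    from (peak w₀≺w₁ w₂≺w₁) = zero , s≤s (s≤s (s≤s z≤n)) , refl , w₂≺w₁ , w₀≺w₁
    from (later p) with from-tail p
    ... | i , h , pin = suc i , s≤s h , pin

  InPinSeq≐Peak : ∀ {k} (f : Fin k → Elem m n) → InPinSeq f ≐ Peak (tabulate f)
  InPinSeq≐Peak {zero}              f = (λ { (_ , () , _) }) , λ ()
  InPinSeq≐Peak {suc zero}          f = (λ { (_ , s≤s () , _) }) , λ { (later ()) }
  InPinSeq≐Peak {suc (suc zero)}    f = (λ { (_ , s≤s (s≤s ()) , _) }) , λ { (later (later ())) }
  InPinSeq≐Peak {suc (suc (suc k))} f = InPinSeq-∷ f (InPinSeq≐Peak (f ∘ Fin.suc))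

  fromTable : (w : Wreath m n) (xs : List (Elem m n)) → map proj₂ xs ↭ map proj₂ (table w) →
              Σ[ w′ ∈ Wreath m n ] table w′ ≡ xs
  fromTable w xs xs↭w = record { fun = f ; bij = Bijective-resp-↭ positions (bij w) } , table≡xs
    where
    len : length xs ≡ n
    len = trans (sym (length-map proj₂ xs))
            (trans (↭-length xs↭w) (trans (length-map proj₂ (table w)) (length-tabulate (fun w))))
    f : Fin n → Elem m n
    f = lookup xs ∘ cast (sym len)
    table≡xs : tabulate f ≡ xs
    table≡xs = tabulate-lookup-cast xs len
    positions : tabulate (proj₂ ∘ f) ↭ tabulate (proj₂ ∘ fun w)
    positions = begin
      tabulate (proj₂ ∘ f)           ≡⟨ map-tabulate f proj₂ ⟨
      map proj₂ (tabulate f)         ≡⟨ cong (map proj₂) table≡xs ⟩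
      map proj₂ xs                   ↭⟨ xs↭w ⟩
      map proj₂ (table w)            ≡⟨ map-tabulate (fun w) proj₂ ⟩
      tabulate (proj₂ ∘ fun w)       ∎
      where open PermutationReasoning

  colour<-upward : ∀ {t} {x y : Elem m n} → colour x < t → x ≺ y → colour y < t
  colour<-upward x<t (inj₁ y<x)         = <-trans y<x x<t
  colour<-upward x<t (inj₂ (refl , _)) = x<t

  recolour-valley : ∀ {t} (w : Wreath m n) X y Z → X ++ y ∷ Z ↭ table w → Peak (X ++ y ∷ Z) ≐ Peak (table w) →
                    Flanked (λ e → y ≺ e × colour e < t) X Z → (c : Fin m) → t ≤ toℕ c →
                    Σ[ w′ ∈ Wreath m n ] ε w′ ≡ toℕ c + sum (map colour (X ++ Z)) × InPin w′ ≐ InPin w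
  recolour-valley {t} w X y Z perm peaks (left , right) c t≤c = w′ , ε≡ , (begin
    InPin w′            ≈⟨ InPinSeq≐Peak (fun w′) ⟩
    Peak (table w′)     ≡⟨ cong Peak table≡ ⟩
    Peak (X ++ y′ ∷ Z)  ≈⟨ Peak-replace X (Maybe.map below left , Maybe.map below right)
                                          (Maybe.map proj₁ left , Maybe.map proj₁ right) ⟩
    Peak (X ++ y ∷ Z)   ≈⟨ peaks ⟩
    Peak (table w)      ≈⟨ ≐-sym (InPinSeq≐Peak (fun w)) ⟩
    InPin w             ∎)
    where
    open import Relation.Binary.Reasoning.Setoid (≐-setoid (Elem m n) 0ℓ)
    y′ : Elem m n
    y′ = c , proj₂ y
    below : ∀ {e} → y ≺ e × colour e < t → y′ ≺ e
    below (_ , e<t) = inj₁ (<-≤-trans e<t t≤c)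
    positions : map proj₂ (X ++ y′ ∷ Z) ↭ map proj₂ (table w)
    positions = ↭-trans (↭-reflexive (trans (map-++ proj₂ X (y′ ∷ Z)) (sym (map-++ proj₂ X (y ∷ Z)))))
                        (↭.map⁺ proj₂ perm)
    w′ = proj₁ (fromTable w (X ++ y′ ∷ Z) positions)
    table≡ = proj₂ (fromTable w (X ++ y′ ∷ Z) positions)
    ε≡ : ε w′ ≡ toℕ c + sum (map colour (X ++ Z))
    ε≡ = trans (ε≡sum-colours w′) (trans (cong (sum ∘ map colour) table≡) (sum-↭ (↭.map⁺ colour (shift y′ X Z))))

  recolouring-into-G : ∀ p .{{_ : NonZero p}} → p < m → (w : Wreath m n) {z : Elem m n} →
                       InPin w z → colour z < m ∸ p → Σ[ w′ ∈ Wreath m n ] InG m p n w′ × InPin w′ ≐ InPin w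
  recolouring-into-G p p<m w z∈Pin colour-z
    with valleyArrangement colour<-upward (table w) (table-unique w) (proj₁ (InPinSeq≐Peak (fun w)) z∈Pin) colour-z
  ... | arrangement X y Z perm peaks walls with colour-fixing p p<m (sum (map colour (X ++ Z)))
  ... | c , m∸p≤c , p∣c+S with recolour-valley w X y Z perm peaks walls c m∸p≤c
  ... | w′ , ε≡ , pins = w′ , subst (p ∣_) (sym ε≡) p∣c+S , pins

mainTheorem16 : (m p r : ℕ) → .{{_ : NonZero m}} → .{{_ : NonZero p}} → .{{_ : NonZero r}}
    → p ∣ m → p < m
    → (P : Subset m (2 * r + 1))
    → APS m 1 (2 * r + 1) P
    → Σ (Elem m (2 * r + 1)) (λ z → (P z ≡ true) × (toℕ (proj₁ z) < m ∸ p))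
    → APS m p (2 * r + 1) P
mainTheorem16 m p r _ p<m P (w , _ , P⇔Pin) (z , Pz , colour-z)
  with recolouring-into-G p p<m w (Equivalence.to (P⇔Pin z) Pz) colour-z
... | w′ , w′∈G , Pin≐ =
  w′ , w′∈G , λ x → mk⇔ (proj₂ Pin≐ ∘ Equivalence.to (P⇔Pin x)) (Equivalence.from (P⇔Pin x) ∘ proj₁ Pin≐)
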